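{- Let $G_1$ and $G_2$ be two finite simple graphs with disjoint vertex sets, neither of which has a well-connected vertex. Then \[ C^\xi(G_1+G_2) = |E(G_1)| + |E(G_2)| + |V(G_1)|\,|V(G_2)|. \]
   Context: A vertex of a graph is well-connected if it is adjacent to all other vertices of the graph. The join $G_1+G_2$ of graphs with disjoint vertex sets $V_1,V_2$ and edge sets $E_1,E_2$ has vertex set $V_1\cup V_2$ and edge set $E_1\cup E_2\cup\{xy : x\in V_1, y\in V_2\}$. For a connected graph $H$, $d_H(v)$ is the degree of $v$, the eccentricity $\varepsilon_H(v)$ is the largest distance from $v$ to any other vertex, and the connective eccentric index is $C^\xi(H)=\sum_{v\in V(H)} \frac{d_H(v)}{\varepsilon_H(v)}$. -}

module Defs where

open import Data.Bool using (Bool; true; false; _∧_; _∨_; if_then_else_)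
open import Data.Nat using (ℕ; zero; suc; _+_; _*_; _<ᵇ_; _⊔_)
open import Data.Fin using (Fin; toℕ; splitAt; _≟_)
open import Data.Sum using (inj₁; inj₂)
open import Data.List using (List; allFin; map; foldr; concatMap)
open import Data.Nat.ListAction using (sum)
open import Data.Bool.ListAction using (any)
open import Data.Integer using (+_)
open import Data.Rational using (ℚ; _/_; 0ℚ) renaming (_+_ to _+ℚ_)
open import Data.Product using (∃; _×_)
open import Relation.Nullary using (¬_; does)
open import Relation.Binary.PropositionalEquality using (_≡_; _≢_)

record SimpleGraph (n : ℕ) : Set where
  field
    adj    : Fin n → Fin n → Bool
    sym    : ∀ i j → adj i j ≡ adj j i
    irrefl : ∀ i → adj i i ≡ false
open SimpleGraph public

Adj : ℕ → Set
Adj n = Fin n → Fin n → Bool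

b2n : Bool → ℕ
b2n true  = 1
b2n false = 0

degree : ∀ {n} → Adj n → Fin n → ℕ
degree {n} a v = sum (map (λ w → b2n (a v w)) (allFin n))

edgeCount : ∀ {n} → SimpleGraph n → ℕ
edgeCount {n} G =
  sum (concatMap (λ i → map (λ j → b2n ((toℕ i <ᵇ toℕ j) ∧ adj G i j)) (allFin n)) (allFin n))

WellConnected : ∀ {n} → SimpleGraph n → Fin n → Set
WellConnected {n} G v = ∀ (w : Fin n) → w ≢ v → adj G v w ≡ true

reach : ∀ {n} → Adj n → ℕ → Fin n → Fin n → Bool
reach a zero    v w = does (v ≟ w)
reach {n} a (suc k) v w = reach a k v w ∨ any (λ u → reach a k v u ∧ a u w) (allFin n)

search : (ℕ → Bool) → ℕ → ℕ → ℕ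
search p k zero    = k
search p k (suc f) = if p k then k else search p (suc k) f

-- distance: least k with a walk of length ≤ k (= length of shortest path);
-- all distances in a connected graph on n vertices are < n
-- (value n means unreachable; irrelevant for connected graphs)
dist : ∀ {n} → Adj n → Fin n → Fin n → ℕ
dist {n} a v w = search (λ k → reach a k v w) 0 n

ecc : ∀ {n} → Adj n → Fin n → ℕ
ecc {n} a v = foldr _⊔_ 0 (map (dist a v) (allFin n))

-- d / e as a rational (e = 0 only for the one-vertex graph, where d = 0)
frac : ℕ → ℕ → ℚ
frac d zero    = 0ℚ
frac d (suc e) = (+ d) / suc e

connEcc : ∀ {n} → Adj n → ℚ
connEcc {n} a = foldr _+ℚ_ 0ℚ (map (λ v → frac (degree a v) (ecc a v)) (allFin n))

-- join G1 + G2 on vertex set Fin (n1 + n2): the first n1 vertices are G1,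
-- the remaining n2 are G2 (so the vertex sets are disjoint)
join : ∀ {n₁ n₂} → SimpleGraph n₁ → SimpleGraph n₂ → Adj (n₁ + n₂)
join {n₁} G₁ G₂ x y with splitAt n₁ x | splitAt n₁ y
... | inj₁ i | inj₁ j = adj G₁ i j
... | inj₂ i | inj₂ j = adj G₂ i j
... | inj₁ _ | inj₂ _ = true
... | inj₂ _ | inj₁ _ = true

module Submission where

-- Write J for the join G₁ + G₂ of two nonempty graphs.  Any two
-- vertices of J are joined by a walk of length at most 2 (through a vertex
-- of the other side), so every eccentricity is at most 2.  If no vertex of
-- G₁ or G₂ is well-connected, every vertex x of J has a non-neighbour
-- w ≠ x on its own side, whence dist(x, w) = 2 and ecc(x) = 2.  Hence
--   C^ξ(J) = ∑ d_J(x) / 2 ,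
-- and the degree sum of J is 2|E(G₁)| + 2|E(G₂)| + 2|V(G₁)||V(G₂)|: a left
-- vertex has its G₁-degree plus |V(G₂)| and symmetrically, and the
-- handshake lemma gives ∑ d_G = 2|E(G)|.

open import Defs
open import Data.Nat using (ℕ; zero; suc; _+_; _*_; _≤_; _<_; _⊔_; _<ᵇ_; z≤n; s≤s)
import Data.Nat.Properties as ℕP
open import Data.Nat.ListAction using (sum)
open import Data.Nat.ListAction.Properties using (sum-++)
open import Data.Nat.Tactic.RingSolver using (solve-∀)
open import Data.Bool as Bool using (Bool; true; false; _∧_; _∨_)
import Data.Bool.Properties as BoolP
open import Data.Fin as Fin using (Fin; toℕ; _↑ˡ_; _↑ʳ_; splitAt)
import Data.Fin.Properties as FinP
open import Data.List using (List; []; _∷_; tabulate; allFin; map; foldr; concatMap)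
import Data.List.Properties as ListP
import Data.Vec.Functional as Vector
open import Data.Sum using (inj₁; inj₂)
open import Data.Product using (∃; _×_; _,_)
open import Data.Empty using (⊥-elim)
open import Data.Integer as ℤ using (+_)
import Data.Integer.Properties as ℤP
open import Data.Rational as ℚ using (ℚ; _/_)
import Data.Rational.Properties as ℚP
open import Data.Rational.Unnormalised as ℚᵘ using (ℚᵘ; mkℚᵘ; _≃_; *≡*)
import Data.Rational.Unnormalised.Properties as ℚᵘP
open import Relation.Binary using (tri<; tri≈; tri>)
open import Relation.Binary.PropositionalEquality
  using (_≡_; _≢_; refl; trans; cong; cong₂; subst; module ≡-Reasoning)
  renaming (sym to ≡-sym)
open import Relation.Nullary using (¬_; yes; no; does; ¬?; _→-dec_)
open import Relation.Nullary.Decidable using (dec-true; dec-false)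
open import Function using (_∘_)
open import Algebra.Properties.CommutativeMonoid.Sum ℕP.+-0-commutativeMonoid
  using (sum-cong-≗; ∑-distrib-+; ∑-comm) renaming (sum to ∑)

-- Folding a list indexed by Fin n is folding the corresponding vector;
-- this turns the list-based sums, disjunctions and maxima of Defs into
-- recursions over Fin n.
foldr-tabulate : ∀ {A B : Set} (f : A → B → B) (z : B) {n} (g : Fin n → A) →
                 foldr f z (tabulate g) ≡ Vector.foldr f z g
foldr-tabulate f z {zero}  g = refl
foldr-tabulate f z {suc n} g = cong (f (g Fin.zero)) (foldr-tabulate f z (g ∘ Fin.suc))

foldr-allFin : ∀ {A B : Set} (f : A → B → B) (z : B) {n} (g : Fin n → A) →
               foldr f z (map g (allFin n)) ≡ Vector.foldr f z g
foldr-allFin f z g =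
  trans (cong (foldr f z) (ListP.map-tabulate (λ i → i) g)) (foldr-tabulate f z g)

sum-concatMap : ∀ {A : Set} (h : A → List ℕ) xs →
                sum (concatMap h xs) ≡ sum (map (sum ∘ h) xs)
sum-concatMap h []       = refl
sum-concatMap h (x ∷ xs) =
  trans (sum-++ (h x) (concatMap h xs)) (cong (_+_ (sum (h x))) (sum-concatMap h xs))

∑-const : ∀ n c → ∑ {n} (λ _ → c) ≡ n * c
∑-const zero    c = refl
∑-const (suc n) c = cong (_+_ c) (∑-const n c)

∑-split : ∀ m {n} (f : Fin (m + n) → ℕ) →
          ∑ f ≡ ∑ (λ i → f (i ↑ˡ n)) + ∑ (λ j → f (m ↑ʳ j))
∑-split zero    f = refl
∑-split (suc m) {n} f =
  trans (cong (_+_ (f Fin.zero)) (∑-split m (f ∘ Fin.suc))) (≡-sym (ℕP.+-assoc (f Fin.zero) (∑ (λ i → f (Fin.suc (i ↑ˡ n)))) (∑ (λ j → f (Fin.suc (m ↑ʳ j))))))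

degree≡∑ : ∀ {n} (a : Adj n) v → degree a v ≡ ∑ (λ w → b2n (a v w))
degree≡∑ a v = foldr-allFin _+_ 0 (λ w → b2n (a v w))

<ᵇ-true : ∀ {m n} → m < n → (m <ᵇ n) ≡ true
<ᵇ-true {m} {n} m<n with m <ᵇ n | ℕP.<⇒<ᵇ m<n
... | true | _ = refl

<ᵇ-false : ∀ {m n} → ¬ m < n → (m <ᵇ n) ≡ false
<ᵇ-false {m} {n} m≮n with m <ᵇ n | ℕP.<ᵇ⇒< m n
... | true  | m<n = ⊥-elim (m≮n (m<n _))
... | false | _   = refl

upperEdge : ∀ {n} → SimpleGraph n → Fin n → Fin n → ℕ
upperEdge G i j = b2n ((toℕ i <ᵇ toℕ j) ∧ adj G i j)

edgeCount≡∑ : ∀ {n} (G : SimpleGraph n) → edgeCount G ≡ ∑ (λ i → ∑ (upperEdge G i))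
edgeCount≡∑ {n} G = begin
  edgeCount G                                           ≡⟨ sum-concatMap row (allFin n) ⟩
  sum (map (sum ∘ row) (allFin n))                      ≡⟨ foldr-allFin _+_ 0 (sum ∘ row) ⟩
  ∑ (sum ∘ row)                                         ≡⟨ sum-cong-≗ (λ i → foldr-allFin _+_ 0 (upperEdge G i)) ⟩
  ∑ (λ i → ∑ (upperEdge G i))                           ∎
  where
  open ≡-Reasoning
  row : Fin n → List ℕ
  row i = map (upperEdge G i) (allFin n)

-- By symmetry and looplessness, each adjacency is counted exactly once
-- among the two ordered pairs (i, j) and (j, i).
adj-split : ∀ {n} (G : SimpleGraph n) i j →
            b2n (adj G i j) ≡ upperEdge G i j + upperEdge G j i
adj-split G i j with ℕP.<-cmp (toℕ i) (toℕ j)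
... | tri< i<j _ j≮i rewrite <ᵇ-true i<j | <ᵇ-false j≮i = ≡-sym (ℕP.+-identityʳ _)
... | tri> i≮j _ j<i rewrite <ᵇ-false i≮j | <ᵇ-true j<i | SimpleGraph.sym G i j = refl
... | tri≈ i≮j i≡j _ with FinP.toℕ-injective i≡j
...   | refl rewrite <ᵇ-false i≮j | irrefl G i = refl

handshake : ∀ {n} (G : SimpleGraph n) → ∑ (degree (adj G)) ≡ edgeCount G + edgeCount G
handshake G = begin
  ∑ (degree (adj G))
    ≡⟨ sum-cong-≗ (degree≡∑ (adj G)) ⟩
  ∑ (λ i → ∑ (λ j → b2n (adj G i j)))
    ≡⟨ sum-cong-≗ (λ i → sum-cong-≗ (adj-split G i)) ⟩
  ∑ (λ i → ∑ (λ j → upperEdge G i j + upperEdge G j i))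
    ≡⟨ sum-cong-≗ (λ i → ∑-distrib-+ (upperEdge G i) (λ j → upperEdge G j i)) ⟩
  ∑ (λ i → ∑ (upperEdge G i) + ∑ (λ j → upperEdge G j i))
    ≡⟨ ∑-distrib-+ (λ i → ∑ (upperEdge G i)) (λ i → ∑ (λ j → upperEdge G j i)) ⟩
  ∑ (λ i → ∑ (upperEdge G i)) + ∑ (λ i → ∑ (λ j → upperEdge G j i))
    ≡⟨ cong (_+_ (∑ (λ i → ∑ (upperEdge G i)))) (∑-comm (λ i j → upperEdge G j i)) ⟩
  ∑ (λ i → ∑ (upperEdge G i)) + ∑ (λ j → ∑ (upperEdge G j))
    ≡⟨ cong₂ _+_ (≡-sym (edgeCount≡∑ G)) (≡-sym (edgeCount≡∑ G)) ⟩
  edgeCount G + edgeCount G ∎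
  where open ≡-Reasoning

⋁-true : ∀ {n} (f : Fin n → Bool) u → f u ≡ true → Vector.foldr _∨_ false f ≡ true
⋁-true f Fin.zero    fu rewrite fu = refl
⋁-true f (Fin.suc u) fu rewrite ⋁-true (f ∘ Fin.suc) u fu = BoolP.∨-zeroʳ (f Fin.zero)

⋁-false : ∀ {n} (f : Fin n → Bool) → (∀ u → f u ≡ false) → Vector.foldr _∨_ false f ≡ false
⋁-false {zero}  f all-false = refl
⋁-false {suc n} f all-false
  rewrite all-false Fin.zero = ⋁-false (f ∘ Fin.suc) (all-false ∘ Fin.suc)

max-upper : ∀ {n} (g : Fin n → ℕ) i → g i ≤ Vector.foldr _⊔_ 0 g
max-upper g Fin.zero    = ℕP.m≤m⊔n (g Fin.zero) _
max-upper g (Fin.suc i) = ℕP.≤-trans (max-upper (g ∘ Fin.suc) i) (ℕP.m≤n⊔m (g Fin.zero) _)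

max-lub : ∀ {n} (g : Fin n → ℕ) c → (∀ i → g i ≤ c) → Vector.foldr _⊔_ 0 g ≤ c
max-lub {zero}  g c bound = z≤n
max-lub {suc n} g c bound = ℕP.⊔-lub (bound Fin.zero) (max-lub (g ∘ Fin.suc) c (bound ∘ Fin.suc))

search-hit : ∀ (p : ℕ → Bool) {k} → p k ≡ true → ∀ fuel → search p k fuel ≡ k
search-hit p pk zero       = refl
search-hit p pk (suc fuel) rewrite pk = refl

search-≤ : ∀ (p : ℕ → Bool) {m} → p m ≡ true → ∀ k fuel → k ≤ m → search p k fuel ≤ m
search-≤ p pm k zero       k≤m = k≤m
search-≤ p pm k (suc fuel) k≤m with p k in pk
... | true  = k≤m
... | false = search-≤ p pm (suc k) fuel (ℕP.≤∧≢⇒< k≤m k≢m)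
  where
  k≢m : k ≢ _
  k≢m refl with trans (≡-sym pk) pm
  ... | ()

search-two : ∀ (p : ℕ → Bool) {fuel} → 2 ≤ fuel →
             p 0 ≡ false → p 1 ≡ false → p 2 ≡ true → search p 0 fuel ≡ 2
search-two p {suc zero}       (s≤s ())
search-two p {suc (suc fuel)} _ p0 p1 p2 rewrite p0 | p1 = search-hit p p2 fuel

reach-refl : ∀ {n} (a : Adj n) k v → reach a k v v ≡ true
reach-refl a zero    v = dec-true (v Fin.≟ v) refl
reach-refl a (suc k) v rewrite reach-refl a k v = refl

reach-step : ∀ {n} (a : Adj n) k v u w →
             reach a k v u ≡ true → a u w ≡ true → reach a (suc k) v w ≡ true
reach-step {n} a k v u w vu uw =
  trans (cong (reach a k v w ∨_)
              (trans (foldr-allFin _∨_ false step) (⋁-true step u (cong₂ _∧_ vu uw))))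
        (BoolP.∨-zeroʳ (reach a k v w))
  where
  step : Fin n → Bool
  step u′ = reach a k v u′ ∧ a u′ w

reach1-false : ∀ {n} (a : Adj n) v w → v ≢ w → a v w ≡ false → reach a 1 v w ≡ false
reach1-false a v w v≢w vw rewrite dec-false (v Fin.≟ w) v≢w =
  trans (foldr-allFin _∨_ false (λ u → does (v Fin.≟ u) ∧ a u w)) (⋁-false _ no-step)
  where
  no-step : ∀ u → (does (v Fin.≟ u) ∧ a u w) ≡ false
  no-step u with v Fin.≟ u
  ... | yes refl = vw
  ... | no _     = refl

distinct⇒2≤n : ∀ {n} (v w : Fin n) → v ≢ w → 2 ≤ n
distinct⇒2≤n {suc zero}    Fin.zero Fin.zero v≢w = ⊥-elim (v≢w refl)
distinct⇒2≤n {suc (suc n)} v        w        v≢w = s≤s (s≤s z≤n)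

dist-≤ : ∀ {n} (a : Adj n) v w k → reach a k v w ≡ true → dist a v w ≤ k
dist-≤ {n} a v w k r = search-≤ (λ j → reach a j v w) r 0 n z≤n

dist≡2 : ∀ {n} (a : Adj n) v w → v ≢ w → a v w ≡ false → reach a 2 v w ≡ true →
         dist a v w ≡ 2
dist≡2 a v w v≢w vw r =
  search-two (λ j → reach a j v w) (distinct⇒2≤n v w v≢w)
             (dec-false (v Fin.≟ w) v≢w) (reach1-false a v w v≢w vw) r

ecc≡2 : ∀ {n} (a : Adj n) v → (∀ w → reach a 2 v w ≡ true) →
        (∃ λ w → v ≢ w × a v w ≡ false) → ecc a v ≡ 2
ecc≡2 a v within2 (w , v≢w , vw) = trans (foldr-allFin _⊔_ 0 (dist a v))
  (ℕP.≤-antisym (max-lub (dist a v) 2 (λ u → dist-≤ a v u 2 (within2 u)))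
                (subst (_≤ _) (dist≡2 a v w v≢w vw (within2 w)) (max-upper (dist a v) w)))

nonNeighbour : ∀ {n} (G : SimpleGraph n) → ¬ (∃ λ v → WellConnected G v) →
               ∀ v → ∃ λ w → v ≢ w × adj G v w ≡ false
nonNeighbour {n} G noWC v
  with FinP.¬∀⟶∃¬ n (λ w → w ≢ v → adj G v w ≡ true)
         (λ w → ¬? (w Fin.≟ v) →-dec (adj G v w Bool.≟ true)) (λ wc → noWC (v , wc))
... | w , ¬adjacent =
  w , (λ v≡w → ¬adjacent (λ w≢v → ⊥-elim (w≢v (≡-sym v≡w))))
    , BoolP.¬-not (λ vw → ¬adjacent (λ _ → vw))

data Side (m n : ℕ) : Fin (m + n) → Set where
  left  : (i : Fin m) → Side m n (i ↑ˡ n)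
  right : (j : Fin n) → Side m n (m ↑ʳ j)

side : ∀ m n x → Side m n x
side m n x = subst (Side m n) (FinP.join-splitAt m n x) (fromSplit (splitAt m x))
  where
  fromSplit : ∀ s → Side m n (Fin.join m n s)
  fromSplit (inj₁ i) = left i
  fromSplit (inj₂ j) = right j

module JoinProperties {m₁ m₂ : ℕ} (G₁ : SimpleGraph m₁) (G₂ : SimpleGraph m₂) where

  J : Adj (m₁ + m₂)
  J = join G₁ G₂

  join-ll : ∀ i j → J (i ↑ˡ m₂) (j ↑ˡ m₂) ≡ adj G₁ i j
  join-ll i j rewrite FinP.splitAt-↑ˡ m₁ i m₂ | FinP.splitAt-↑ˡ m₁ j m₂ = refl

  join-lr : ∀ i j → J (i ↑ˡ m₂) (m₁ ↑ʳ j) ≡ true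
  join-lr i j rewrite FinP.splitAt-↑ˡ m₁ i m₂ | FinP.splitAt-↑ʳ m₁ m₂ j = refl

  join-rl : ∀ i j → J (m₁ ↑ʳ i) (j ↑ˡ m₂) ≡ true
  join-rl i j rewrite FinP.splitAt-↑ʳ m₁ m₂ i | FinP.splitAt-↑ˡ m₁ j m₂ = refl

  join-rr : ∀ i j → J (m₁ ↑ʳ i) (m₁ ↑ʳ j) ≡ adj G₂ i j
  join-rr i j rewrite FinP.splitAt-↑ʳ m₁ m₂ i | FinP.splitAt-↑ʳ m₁ m₂ j = refl

  via : ∀ {x w} u → J x u ≡ true → J u w ≡ true → reach J 2 x w ≡ true
  via {x} {w} u xu uw = reach-step J 1 x u w (reach-step J 0 x x u (reach-refl J 0 x) xu) uw

  -- The join of two nonempty graphs has diameter at most 2: go across,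
  -- and come back across if the target is on the starting side.
  join-within2 : Fin m₁ → Fin m₂ → ∀ x w → reach J 2 x w ≡ true
  join-within2 l r x w with side m₁ m₂ x | side m₁ m₂ w
  ... | left i  | left k  = via (m₁ ↑ʳ r) (join-lr i r) (join-rl r k)
  ... | left i  | right k = reach-step J 1 (i ↑ˡ m₂) (i ↑ˡ m₂) (m₁ ↑ʳ k) (reach-refl J 1 (i ↑ˡ m₂)) (join-lr i k)
  ... | right i | left k  = reach-step J 1 (m₁ ↑ʳ i) (m₁ ↑ʳ i) (k ↑ˡ m₂) (reach-refl J 1 (m₁ ↑ʳ i)) (join-rl i k)
  ... | right i | right k = via (l ↑ˡ m₂) (join-rl i l) (join-lr l k)

  -- Without well-connected vertices, a non-neighbour inside G₁ or G₂ stays a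
  -- non-neighbour in the join, so every vertex has eccentricity 2.
  join-ecc≡2 : Fin m₁ → Fin m₂ → ¬ (∃ λ v → WellConnected G₁ v) →
               ¬ (∃ λ v → WellConnected G₂ v) → ∀ x → ecc J x ≡ 2
  join-ecc≡2 l r noWC₁ noWC₂ x with side m₁ m₂ x
  ... | left i with nonNeighbour G₁ noWC₁ i
  ...   | k , i≢k , ik = ecc≡2 J (i ↑ˡ m₂) (join-within2 l r (i ↑ˡ m₂))
                           (k ↑ˡ m₂ , i≢k ∘ FinP.↑ˡ-injective m₂ i k , trans (join-ll i k) ik)
  join-ecc≡2 l r noWC₁ noWC₂ x | right i with nonNeighbour G₂ noWC₂ i
  ...   | k , i≢k , ik = ecc≡2 J (m₁ ↑ʳ i) (join-within2 l r (m₁ ↑ʳ i))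
                           (m₁ ↑ʳ k , i≢k ∘ FinP.↑ʳ-injective m₁ i k , trans (join-rr i k) ik)

  degree-left : ∀ i → degree J (i ↑ˡ m₂) ≡ degree (adj G₁) i + m₂
  degree-left i = begin
    degree J (i ↑ˡ m₂)
      ≡⟨ trans (degree≡∑ J _) (∑-split m₁ _) ⟩
    ∑ (λ k → b2n (J (i ↑ˡ m₂) (k ↑ˡ m₂))) + ∑ (λ k → b2n (J (i ↑ˡ m₂) (m₁ ↑ʳ k)))
      ≡⟨ cong₂ _+_ (sum-cong-≗ (cong b2n ∘ join-ll i)) (sum-cong-≗ (cong b2n ∘ join-lr i)) ⟩
    ∑ (λ k → b2n (adj G₁ i k)) + ∑ {m₂} (λ _ → 1)
      ≡⟨ cong₂ _+_ (≡-sym (degree≡∑ (adj G₁) i)) (trans (∑-const m₂ 1) (ℕP.*-identityʳ m₂)) ⟩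
    degree (adj G₁) i + m₂ ∎
    where open ≡-Reasoning

  degree-right : ∀ j → degree J (m₁ ↑ʳ j) ≡ m₁ + degree (adj G₂) j
  degree-right j = begin
    degree J (m₁ ↑ʳ j)
      ≡⟨ trans (degree≡∑ J _) (∑-split m₁ _) ⟩
    ∑ (λ k → b2n (J (m₁ ↑ʳ j) (k ↑ˡ m₂))) + ∑ (λ k → b2n (J (m₁ ↑ʳ j) (m₁ ↑ʳ k)))
      ≡⟨ cong₂ _+_ (sum-cong-≗ (cong b2n ∘ join-rl j)) (sum-cong-≗ (cong b2n ∘ join-rr j)) ⟩
    ∑ {m₁} (λ _ → 1) + ∑ (λ k → b2n (adj G₂ j k))
      ≡⟨ cong₂ _+_ (trans (∑-const m₁ 1) (ℕP.*-identityʳ m₁)) (≡-sym (degree≡∑ (adj G₂) j)) ⟩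
    m₁ + degree (adj G₂) j ∎
    where open ≡-Reasoning

  join-degreeSum : let k = edgeCount G₁ + edgeCount G₂ + m₁ * m₂ in
                   ∑ (degree J) ≡ k + k
  join-degreeSum = begin
    ∑ (degree J)
      ≡⟨ ∑-split m₁ (degree J) ⟩
    ∑ (λ i → degree J (i ↑ˡ m₂)) + ∑ (λ j → degree J (m₁ ↑ʳ j))
      ≡⟨ cong₂ _+_ (trans (sum-cong-≗ degree-left) (∑-distrib-+ (degree (adj G₁)) (λ _ → m₂)))
                   (trans (sum-cong-≗ degree-right) (∑-distrib-+ (λ _ → m₁) (degree (adj G₂)))) ⟩
    (∑ (degree (adj G₁)) + ∑ {m₁} (λ _ → m₂)) + (∑ {m₂} (λ _ → m₁) + ∑ (degree (adj G₂)))
      ≡⟨ cong₂ _+_ (cong₂ _+_ (handshake G₁) (∑-const m₁ m₂))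
                   (cong₂ _+_ (∑-const m₂ m₁) (handshake G₂)) ⟩
    (E₁ + E₁ + m₁ * m₂) + (m₂ * m₁ + (E₂ + E₂))
      ≡⟨ rearrange E₁ E₂ m₁ m₂ ⟩
    (E₁ + E₂ + m₁ * m₂) + (E₁ + E₂ + m₁ * m₂) ∎
    where
    open ≡-Reasoning
    E₁ = edgeCount G₁
    E₂ = edgeCount G₂
    rearrange : ∀ a b x y → (a + a + x * y) + (y * x + (b + b)) ≡ (a + b + x * y) + (a + b + x * y)
    rearrange = solve-∀

-- d/2 as an unnormalised rational; (+ d) / 2 is its normalisation.
half : ℕ → ℚᵘ
half d = mkℚᵘ (+ d) 1

half-+ᵘ : ∀ a b → half a ℚᵘ.+ half b ≃ half (a + b)
half-+ᵘ a b = *≡* (begin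
  (+ a ℤ.* + 2 ℤ.+ + b ℤ.* + 2) ℤ.* + 2
    ≡⟨ cong (ℤ._* + 2) (cong₂ ℤ._+_ (≡-sym (ℤP.pos-* a 2)) (≡-sym (ℤP.pos-* b 2))) ⟩
  (+ (a * 2) ℤ.+ + (b * 2)) ℤ.* + 2
    ≡⟨ cong (ℤ._* + 2) (≡-sym (ℤP.pos-+ (a * 2) (b * 2))) ⟩
  + (a * 2 + b * 2) ℤ.* + 2
    ≡⟨ ≡-sym (ℤP.pos-* (a * 2 + b * 2) 2) ⟩
  + ((a * 2 + b * 2) * 2)
    ≡⟨ cong +_ (cross-multiplied a b) ⟩
  + ((a + b) * 4)
    ≡⟨ ℤP.pos-* (a + b) 4 ⟩
  + (a + b) ℤ.* + 4 ∎)
  where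
  open ≡-Reasoning
  cross-multiplied : ∀ a b → (a * 2 + b * 2) * 2 ≡ (a + b) * 4
  cross-multiplied = solve-∀

half-+ : ∀ a b → (+ a) / 2 ℚ.+ (+ b) / 2 ≡ (+ (a + b)) / 2
half-+ a b = ℚP.toℚᵘ-injective
  (ℚᵘP.≃-trans (ℚP.toℚᵘ-homo-+ ((+ a) / 2) ((+ b) / 2))
  (ℚᵘP.≃-trans (ℚᵘP.+-cong (ℚP.toℚᵘ-fromℚᵘ (half a)) (ℚP.toℚᵘ-fromℚᵘ (half b)))
  (ℚᵘP.≃-trans (half-+ᵘ a b) (ℚᵘP.≃-sym (ℚP.toℚᵘ-fromℚᵘ (half (a + b)))))))

∑-halves : ∀ {n} (q : Fin n → ℚ) (d : Fin n → ℕ) → (∀ v → q v ≡ (+ d v) / 2) →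
           Vector.foldr ℚ._+_ ℚ.0ℚ q ≡ (+ ∑ d) / 2
∑-halves {zero}  q d q≡ = refl
∑-halves {suc n} q d q≡ =
  trans (cong₂ ℚ._+_ (q≡ Fin.zero) (∑-halves (q ∘ Fin.suc) (d ∘ Fin.suc) (q≡ ∘ Fin.suc)))
        (half-+ (d Fin.zero) (∑ (d ∘ Fin.suc)))

connEcc-ecc≡2 : ∀ {n} (a : Adj n) → (∀ v → ecc a v ≡ 2) → connEcc a ≡ (+ ∑ (degree a)) / 2
connEcc-ecc≡2 a ecc2 = trans (foldr-allFin ℚ._+_ ℚ.0ℚ (λ v → frac (degree a v) (ecc a v))) (∑-halves _ (degree a) term)
  where
  term : ∀ v → frac (degree a v) (ecc a v) ≡ (+ degree a v) / 2
  term v rewrite ecc2 v = refl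

double/2 : ∀ k → (+ (k + k)) / 2 ≡ (+ k) / 1
double/2 k = ℚP.fromℚᵘ-cong {mkℚᵘ (+ (k + k)) 1} {mkℚᵘ (+ k) 0} (*≡* (begin
  + (k + k) ℤ.* + 1  ≡⟨ ≡-sym (ℤP.pos-* (k + k) 1) ⟩
  + ((k + k) * 1)    ≡⟨ cong +_ (cross-multiplied k) ⟩
  + (k * 2)          ≡⟨ ℤP.pos-* k 2 ⟩
  + k ℤ.* + 2        ∎))
  where
  open ≡-Reasoning
  cross-multiplied : ∀ k → (k + k) * 1 ≡ k * 2
  cross-multiplied = solve-∀

theorem3 : ∀ {n₁ n₂ : ℕ} (G₁ : SimpleGraph (suc n₁)) (G₂ : SimpleGraph (suc n₂))
    → ¬ (∃ λ v → WellConnected G₁ v)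
    → ¬ (∃ λ v → WellConnected G₂ v)
    → connEcc (join G₁ G₂)
      ≡ (+ (edgeCount G₁ + edgeCount G₂ + suc n₁ * suc n₂)) / 1
theorem3 {n₁} {n₂} G₁ G₂ noWC₁ noWC₂ = begin
  connEcc J                  ≡⟨ connEcc-ecc≡2 J (join-ecc≡2 Fin.zero Fin.zero noWC₁ noWC₂) ⟩
  (+ ∑ (degree J)) / 2       ≡⟨ cong (λ d → (+ d) / 2) join-degreeSum ⟩
  (+ (k + k)) / 2            ≡⟨ double/2 k ⟩
  (+ k) / 1                  ∎
  where
  open ≡-Reasoning
  open JoinProperties G₁ G₂
  k : ℕ
  k = edgeCount G₁ + edgeCount G₂ + suc n₁ * suc n₂
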